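{- Let $G$ be a minimal counterexample (as defined in the context). Then for every edge $uv\in E(G)$ with $\min\{d(u),d(v)\}\leq \left\lfloor \frac{M+2d-1}{2d}\right\rfloor$, we have $d(u)+d(v)\geq M+3$.
   Context: Fix an integer $d\geq 2$, a surface of Euler characteristic $\varepsilon$, and an integer $M$ such that either (i) $\varepsilon\leq 0$ and $M\geq \frac{d}{2d-1}\left(10d-8+\sqrt{(10d-2)^2-24(2d-1)\varepsilon}\right)+1$, or (ii) $\varepsilon>0$ and $M\geq 5d+2$. A minimal counterexample is a finite simple graph $G$ embedded in this surface with $\Delta(G)\leq M$ that is not $(M+2d)$-$(d,1)$-total choosable, such that $|V(G)|+|E(G)|$ is minimum among all such graphs (so every finite simple graph embedded in this surface with maximum degree at most $M$ and smaller value of $|V|+|E|$ is $(M+2d)$-$(d,1)$-total choosable). Here a $(d,1)$-total labelling is an assignment $c$ of integers to $V(G)\cup E(G)$ with $c(u)\neq c(v)$ for adjacent vertices, $c(e)\neq c(e')$ for adjacent edges, and $|c(u)-c(e)|\geq d$ for $u$ incident with $e$; $G$ is $k$-$(d,1)$-total choosable if for every assignment of lists $L(x)$ of $k$ integers to each $x\in V(G)\cup E(G)$ there is such a labelling with $c(x)\in L(x)$ for all $x$. $d(v)$ denotes the degree of $v$ in $G$. -}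

module Defs where

open import Level using (0ℓ)
open import Function using (_∘_)
open import Function.Definitions using (Injective)
open import Data.Nat as ℕ using (ℕ; zero; suc; _+_; _*_; _∸_; _≤_; _<_; _<ᵇ_; _/_)
open import Data.Integer as ℤ using (ℤ; +_; ∣_∣)
open import Data.Fin using (Fin; toℕ)
open import Data.Bool using (Bool; true; false; if_then_else_; _∧_)
open import Data.List using (List; length)
open import Data.List.Membership.Propositional using (_∈_)
open import Data.List.Relation.Unary.Unique.Propositional using (Unique)
open import Data.Product using (Σ; ∃; _×_; _,_)
open import Data.Sum using (_⊎_; inj₁; inj₂)
open import Relation.Nullary using (¬_)
open import Relation.Binary.PropositionalEquality using (_≡_; _≢_)

record Graph : Set where
  field
    n      : ℕ
    adj    : Fin n → Fin n → Bool
    sym    : ∀ i j → adj i j ≡ adj j i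
    irrefl : ∀ i → adj i i ≡ false
open Graph public

count : ∀ {m} → (Fin m → Bool) → ℕ
count {zero}  f = 0
count {suc m} f = (if f Data.Fin.zero then 1 else 0) + count (f ∘ Data.Fin.suc)

sumFin : ∀ {m} → (Fin m → ℕ) → ℕ
sumFin {zero}  f = 0
sumFin {suc m} f = f Data.Fin.zero + sumFin (f ∘ Data.Fin.suc)

deg : (G : Graph) → Fin (n G) → ℕ
deg G v = count (adj G v)

numEdges : Graph → ℕ
numEdges G = sumFin (λ i → count (λ j → (toℕ i <ᵇ toℕ j) ∧ adj G i j))

size : Graph → ℕ
size G = n G + numEdges G

MaxDegAtMost : Graph → ℕ → Set
MaxDegAtMost G M = ∀ v → deg G v ≤ M

record Edge (G : Graph) : Set where
  constructor edge
  field
    eu   : Fin (n G)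
    ev   : Fin (n G)
    u<v  : toℕ eu < toℕ ev
    isAdj : adj G eu ev ≡ true
open Edge public

Incident : (G : Graph) → Fin (n G) → Edge G → Set
Incident G x e = x ≡ eu e ⊎ x ≡ ev e

AdjacentEdges : (G : Graph) → Edge G → Edge G → Set
AdjacentEdges G e e' =
  (∃ λ x → Incident G x e × Incident G x e') × ¬ (eu e ≡ eu e' × ev e ≡ ev e')

Elem : Graph → Set
Elem G = Fin (n G) ⊎ Edge G

IsD1TotalLabelling : ℕ → (G : Graph) → (Elem G → ℤ) → Set
IsD1TotalLabelling d G c =
  (∀ u v → adj G u v ≡ true → c (inj₁ u) ≢ c (inj₁ v)) ×
  (∀ e e' → AdjacentEdges G e e' → c (inj₂ e) ≢ c (inj₂ e')) ×
  (∀ u e → Incident G u e → d ≤ ∣ c (inj₁ u) ℤ.- c (inj₂ e) ∣)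

IsKList : ℕ → List ℤ → Set
IsKList k L = length L ≡ k × Unique L

TotalChoosable : ℕ → ℕ → Graph → Set
TotalChoosable d k G =
  (L : Elem G → List ℤ) → (∀ x → IsKList k (L x)) →
  ∃ λ (c : Elem G → ℤ) → IsD1TotalLabelling d G c × (∀ x → c x ∈ L x)

Subgraph : Graph → Graph → Set
Subgraph H G =
  Σ (Fin (n H) → Fin (n G)) λ f →
    Injective _≡_ _≡_ f × (∀ i j → adj H i j ≡ true → adj G (f i) (f j) ≡ true)

record Surface : Set₁ where
  field
    euler        : ℤ
    EmbeddedIn   : Graph → Set
    subgraph-closed : ∀ {H G} → Subgraph H G → EmbeddedIn G → EmbeddedIn H
open Surface public

-- hypothesis (i) or (ii) on M; (i) squared out:
-- M ≥ d/(2d-1)(10d-8+√((10d-2)²-24(2d-1)ε))+1  ⇔  X ≥ 0 ∧ d²·D ≤ X²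
-- with X = (2d-1)(M-1) - d(10d-8), D = (10d-2)² - 24(2d-1)ε
MCondition : ℕ → ℤ → ℕ → Set
MCondition d ε M =
  (ε ℤ.≤ + 0 × + 0 ℤ.≤ X × (D' ℤ.* D) ℤ.≤ X ℤ.* X)
  ⊎ (+ 0 ℤ.< ε × 5 * d + 2 ≤ M)
  where
    d' = + d
    D' = d' ℤ.* d'
    X = (+ 2 ℤ.* d' ℤ.- + 1) ℤ.* (+ M ℤ.- + 1) ℤ.- d' ℤ.* (+ 10 ℤ.* d' ℤ.- + 8)
    D = (+ 10 ℤ.* d' ℤ.- + 2) ℤ.* (+ 10 ℤ.* d' ℤ.- + 2)
        ℤ.- + 24 ℤ.* (+ 2 ℤ.* d' ℤ.- + 1) ℤ.* ε

MinimalCounterexample : ℕ → ℕ → Surface → Graph → Set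
MinimalCounterexample d M S G =
  EmbeddedIn S G × MaxDegAtMost G M × ¬ TotalChoosable d (M + 2 * d) G ×
  (∀ H → EmbeddedIn S H → MaxDegAtMost H M → size H < size G →
     TotalChoosable d (M + 2 * d) H)

-- ⌊(M+2d-1)/(2d)⌋ (for d ≥ 1; d = 0 never used)
degBound : ℕ → ℕ → ℕ
degBound zero    M = 0
degBound (suc d) M = (M + 2 * suc d ∸ 1) / (2 * suc d)

-- Delete the edge e = ab, where a is the endpoint of smaller degree, and label G − e from the
-- same lists by minimality: G − e is still embedded, has Δ ≤ M and is smaller.  Suppose
-- d(a) + d(b) ≤ M + 2.  The edge e must avoid the labels of the other d(a) − 1 + d(b) − 1 edges at
-- a and b and the 2d − 1 integers within distance d − 1 of the label of b: fewer than M + 2d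
-- values.  Then a is relabelled, avoiding the labels of its d(a) neighbours and the 2d − 1
-- integers around the label of each of its d(a) incident edges: d(a)·2d values in all, which
-- is below M + 2d exactly when d(a) ≤ ⌊(M + 2d − 1)/2d⌋.  So G would be choosable after all.

module Submission where

open import Defs
open import Data.Nat using (ℕ; _+_; _≤_; _⊓_)
open import Data.Integer using (ℤ)

open import Axiom.UniquenessOfIdentityProofs using (module Decidable⇒UIP)
open import Data.Bool using (Bool; true; false; if_then_else_; _∧_; not)
import Data.Bool.Properties as Boolₚ
open import Data.Empty using (⊥-elim)
open import Data.Fin using (Fin; toℕ) renaming (zero to fzero; suc to fsuc)
import Data.Fin as Fin
import Data.Fin.Properties as Finₚ
open import Data.Integer as ℤ using (+_; -[1+_]; ∣_∣)
import Data.Integer.Properties as ℤₚ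
import Data.Integer.Tactic.RingSolver as ℤ-Solver
open import Data.List using (List; []; _∷_; length; _++_; filter; map; concatMap)
import Data.List.Properties as Listₚ
open import Data.List.Membership.Propositional using (_∈_; _∉_)
open import Data.List.Membership.Propositional.Properties
  using (∈-filter⁺; ∈-++⁺ˡ; ∈-++⁺ʳ; ∈-map⁺; ∈-concat⁺′)
open import Data.List.Relation.Unary.Any using (here; there)
import Data.List.Relation.Unary.Any as Any
import Data.List.Relation.Unary.All as All
open import Data.List.Relation.Unary.AllPairs using (_∷_)
open import Data.List.Relation.Unary.Unique.Propositional using (Unique)
open import Data.Nat using (zero; suc; _*_; _∸_; _<_; z≤n; s≤s; _<ᵇ_; _≤?_; NonZero; >-nonZero⁻¹)
import Data.Nat.Properties as ℕₚ
open import Data.Nat.DivMod using (_/_; m/n*n≤m)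
import Data.Nat.Tactic.RingSolver as ℕ-Solver
open import Data.Product using (∃; ∃₂; _×_; _,_; proj₁; proj₂)
open import Data.Sum using (_⊎_; inj₁; inj₂; [_,_]; swap; map₂)
open import Function using (_∘_; id; mk⇔; Equivalence)
open import Relation.Binary using (DecidableEquality; tri<; tri≈; tri>)
open import Relation.Binary.PropositionalEquality as ≡
  using (_≡_; _≢_; refl; trans; cong; cong₂; subst)
open import Relation.Nullary using (¬_; Dec; yes; no; does; ¬?)
open import Relation.Nullary.Decidable using (_×-dec_; _⊎-dec_; map′; dec-true; dec-false; does-⇔)

-- Counting

private
  indicator-mono : ∀ {x y : Bool} → (x ≡ true → y ≡ true) →
                   (if x then 1 else 0) ≤ (if y then 1 else 0)
  indicator-mono {false} _   = z≤n
  indicator-mono {true}  x⇒y rewrite x⇒y refl = ℕₚ.≤-refl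

count-mono : ∀ {m} {f g : Fin m → Bool} → (∀ i → f i ≡ true → g i ≡ true) → count f ≤ count g
count-mono {zero}  f⊆g = z≤n
count-mono {suc m} f⊆g = ℕₚ.+-mono-≤ (indicator-mono (f⊆g fzero)) (count-mono (f⊆g ∘ fsuc))

count-< : ∀ {m} {f g : Fin m → Bool} → (∀ i → f i ≡ true → g i ≡ true) →
          ∀ i → f i ≡ false → g i ≡ true → count f < count g
count-< {suc m} f⊆g fzero    fi gi rewrite fi | gi = s≤s (count-mono (f⊆g ∘ fsuc))
count-< {suc m} f⊆g (fsuc i) fi gi =
  ℕₚ.+-mono-≤-< (indicator-mono (f⊆g fzero)) (count-< (f⊆g ∘ fsuc) i fi gi)

sumFin-mono : ∀ {m} {f g : Fin m → ℕ} → (∀ i → f i ≤ g i) → sumFin f ≤ sumFin g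
sumFin-mono {zero}  f≤g = z≤n
sumFin-mono {suc m} f≤g = ℕₚ.+-mono-≤ (f≤g fzero) (sumFin-mono (f≤g ∘ fsuc))

sumFin-< : ∀ {m} {f g : Fin m → ℕ} → (∀ i → f i ≤ g i) → ∀ i → f i < g i → sumFin f < sumFin g
sumFin-< {suc m} f≤g fzero    fi<gi = ℕₚ.+-mono-<-≤ fi<gi (sumFin-mono (f≤g ∘ fsuc))
sumFin-< {suc m} f≤g (fsuc i) fi<gi = ℕₚ.+-mono-≤-< (f≤g fzero) (sumFin-< (f≤g ∘ fsuc) i fi<gi)

module _ {a} {A : Set a} where

  private
    consIf : (b : Bool) → (b ≡ true → A) → List A → List A
    consIf true  x xs = x refl ∷ xs
    consIf false _ xs = xs

  collect : ∀ {m} (f : Fin m → Bool) → ((i : Fin m) → f i ≡ true → A) → List A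
  collect {zero}  f g = []
  collect {suc m} f g = consIf (f fzero) (g fzero) (collect (f ∘ fsuc) (g ∘ fsuc))

  length-collect : ∀ {m} (f : Fin m → Bool) (g : (i : Fin m) → f i ≡ true → A) →
                   length (collect f g) ≡ count f
  length-collect {zero}  f g = refl
  length-collect {suc m} f g with f fzero | g fzero
  ... | true  | _ = cong suc (length-collect (f ∘ fsuc) (g ∘ fsuc))
  ... | false | _ = length-collect (f ∘ fsuc) (g ∘ fsuc)

  ∈-collect : ∀ {m} (f : Fin m → Bool) (g : (i : Fin m) → f i ≡ true → A) →
              ∀ i (fi : f i ≡ true) → g i fi ∈ collect f g
  ∈-collect {suc m} f g fzero fi with f fzero | g fzero | fi
  ... | .true | x | refl = here refl
  ∈-collect {suc m} f g (fsuc i) fi with f fzero | g fzero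
  ... | true  | _ = there (∈-collect (f ∘ fsuc) (g ∘ fsuc) i fi)
  ... | false | _ = ∈-collect (f ∘ fsuc) (g ∘ fsuc) i fi

module _ {a} {A : Set a} (_≟_ : DecidableEquality A) where

  open import Data.List.Membership.DecPropositional _≟_ using (_∈?_)

  ∃∉-longer : (L F : List A) → Unique L → length F < length L → ∃ λ x → x ∈ L × x ∉ F
  ∃∉-longer (x ∷ xs) F (x∉xs ∷ unique) |F|<|L| with x ∈? F
  ... | no x∉F = x , here refl , x∉F
  ... | yes x∈F =
    let (y , y∈xs , y∉F-x) = ∃∉-longer xs F-x unique (ℕₚ.≤-trans |F-x|<|F| (ℕₚ.≤-pred |F|<|L|))
    in y , there y∈xs ,
       λ y∈F → y∉F-x (∈-filter⁺ (λ z → ¬? (z ≟ x)) y∈F (All.lookup x∉xs y∈xs ∘ ≡.sym))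
    where
    F-x : List A
    F-x = filter (λ y → ¬? (y ≟ x)) F
    |F-x|<|F| : length F-x < length F
    |F-x|<|F| = Listₚ.filter-notAll (λ y → ¬? (y ≟ x)) F (Any.map (λ y≡x y≢x → y≢x (≡.sym y≡x)) x∈F)

-- Balls of integers

nonzeroUpTo : ℕ → List ℤ
nonzeroUpTo zero    = []
nonzeroUpTo (suc r) = + suc r ∷ -[1+ r ] ∷ nonzeroUpTo r

length-nonzeroUpTo : ∀ r → length (nonzeroUpTo r) ≡ r + r
length-nonzeroUpTo zero    = refl
length-nonzeroUpTo (suc r) = cong suc (trans (cong suc (length-nonzeroUpTo r)) (≡.sym (ℕₚ.+-suc r r)))

∈-nonzeroUpTo : ∀ {r j} → j < r → + suc j ∈ nonzeroUpTo r × -[1+ j ] ∈ nonzeroUpTo r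
∈-nonzeroUpTo {suc r} {j} (s≤s j≤r) with ℕₚ.m≤n⇒m<n∨m≡n j≤r
... | inj₂ refl = here refl , there (here refl)
... | inj₁ j<r  = let (+j∈ , -j∈) = ∈-nonzeroUpTo j<r in there (there +j∈) , there (there -j∈)

offsets : ℕ → List ℤ
offsets r = + 0 ∷ nonzeroUpTo r

∈-offsets : ∀ {r} t → ∣ t ∣ ≤ r → t ∈ offsets r
∈-offsets (+ zero)  _   = here refl
∈-offsets (+ suc j) j<r = there (proj₁ (∈-nonzeroUpTo j<r))
∈-offsets -[1+ j ]  j<r = there (proj₂ (∈-nonzeroUpTo j<r))

ball : ℕ → ℤ → List ℤ
ball r c = map (λ t → c ℤ.+ t) (offsets r)

length-ball : ∀ r c → length (ball r c) ≡ suc (r + r)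
length-ball r c = trans (Listₚ.length-map (λ t → c ℤ.+ t) (offsets r)) (cong suc (length-nonzeroUpTo r))

∉-ball⇒far : ∀ {r c x} → x ∉ ball r c → suc r ≤ ∣ x ℤ.- c ∣
∉-ball⇒far {r} {c} {x} x∉ with suc r ≤? ∣ x ℤ.- c ∣
... | yes far = far
... | no ¬far = ⊥-elim (x∉ (subst (_∈ ball r c) (c+[x-c]≡x c x)
                              (∈-map⁺ (λ t → c ℤ.+ t) (∈-offsets (x ℤ.- c) (ℕₚ.≤-pred (ℕₚ.≰⇒> ¬far))))))
  where
  c+[x-c]≡x : ∀ c x → c ℤ.+ (x ℤ.- c) ≡ x
  c+[x-c]≡x = ℤ-Solver.solve-∀

balls : ℕ → List ℤ → List ℤ
balls r = concatMap (ball r)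

length-balls : ∀ r cs → length (balls r cs) ≡ length cs * suc (r + r)
length-balls r []       = refl
length-balls r (c ∷ cs) =
  trans (Listₚ.length-++ (ball r c)) (cong₂ _+_ (length-ball r c) (length-balls r cs))

∉-balls⇒far : ∀ {r cs x y} → x ∉ balls r cs → y ∈ cs → suc r ≤ ∣ x ℤ.- y ∣
∉-balls⇒far {r} x∉ y∈cs = ∉-ball⇒far (λ x∈ → x∉ (∈-concat⁺′ x∈ (∈-map⁺ (ball r) y∈cs)))

-- Edges and edge deletion

module _ {G : Graph} where

  edge-≡ : {e f : Edge G} → eu e ≡ eu f → ev e ≡ ev f → e ≡ f
  edge-≡ {edge x y x<y xy} {edge .x .y x<y′ xy′} refl refl =
    cong₂ (edge x y) (ℕₚ.<-irrelevant x<y x<y′) (Decidable⇒UIP.≡-irrelevant Boolₚ._≟_ xy xy′)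

  _≟ₑ_ : DecidableEquality (Edge G)
  e ≟ₑ f = map′ (λ (p , q) → edge-≡ p q) (λ e≡f → cong eu e≡f , cong ev e≡f)
                ((eu e Fin.≟ eu f) ×-dec (ev e Fin.≟ ev f))

  data Joins (e : Edge G) : Fin (n G) → Fin (n G) → Set where
    forward  : Joins e (eu e) (ev e)
    backward : Joins e (ev e) (eu e)

  joins? : ∀ e x y → Dec (Joins e x y)
  joins? e x y = map′ fromEqs toEqs (((x Fin.≟ eu e) ×-dec (y Fin.≟ ev e)) ⊎-dec
                                     ((x Fin.≟ ev e) ×-dec (y Fin.≟ eu e)))
    where
    fromEqs : (x ≡ eu e × y ≡ ev e) ⊎ (x ≡ ev e × y ≡ eu e) → Joins e x y
    fromEqs (inj₁ (refl , refl)) = forward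
    fromEqs (inj₂ (refl , refl)) = backward
    toEqs : Joins e x y → (x ≡ eu e × y ≡ ev e) ⊎ (x ≡ ev e × y ≡ eu e)
    toEqs forward  = inj₁ (refl , refl)
    toEqs backward = inj₂ (refl , refl)

  Joins-sym : ∀ {e x y} → Joins e x y → Joins e y x
  Joins-sym forward  = backward
  Joins-sym backward = forward

  Joins⇒≡ : ∀ {e f x y} → Joins e x y → Joins f x y → e ≡ f
  Joins⇒≡ {edge _ _ _ _}   {edge _ _ _ _}   forward  forward  = edge-≡ refl refl
  Joins⇒≡ {edge _ _ _ _}   {edge _ _ _ _}   backward backward = edge-≡ refl refl
  Joins⇒≡ {edge _ _ u<v _} {edge _ _ v<u _} forward  backward = ⊥-elim (ℕₚ.<-asym u<v v<u)
  Joins⇒≡ {edge _ _ u<v _} {edge _ _ v<u _} backward forward  = ⊥-elim (ℕₚ.<-asym u<v v<u)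

  Joins⇒adj : ∀ {e x y} → Joins e x y → adj G x y ≡ true
  Joins⇒adj {e} forward  = isAdj e
  Joins⇒adj {e} backward = trans (Graph.sym G (ev e) (eu e)) (isAdj e)

  incident⇒Joins : ∀ {w e} → Incident G w e → ∃ λ x → Joins e w x
  incident⇒Joins {e = e} (inj₁ refl) = ev e , forward
  incident⇒Joins {e = e} (inj₂ refl) = eu e , backward

  Joins-incident : ∀ {e a b x} → Joins e a b → Incident G x e → x ≡ a ⊎ x ≡ b
  Joins-incident forward  = id
  Joins-incident backward = swap

  Joins-endpoint : ∀ {e a b x y} → Joins e a b → Joins e x y → x ≡ a ⊎ y ≡ a
  Joins-endpoint forward  forward  = inj₁ refl
  Joins-endpoint forward  backward = inj₂ refl
  Joins-endpoint backward forward  = inj₂ refl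
  Joins-endpoint backward backward = inj₁ refl

  ¬adj-self : ∀ {x} → adj G x x ≢ true
  ¬adj-self {x} xx with trans (≡.sym xx) (irrefl G x)
  ... | ()

  edgeJoining : ∀ {x y} → adj G x y ≡ true → ∃ λ e → Joins e x y
  edgeJoining {x} {y} xy with ℕₚ.<-cmp (toℕ x) (toℕ y)
  ... | tri< x<y _ _ = edge x y x<y xy , forward
  ... | tri≈ _ x≡y _ =
    ⊥-elim (¬adj-self (subst (λ z → adj G x z ≡ true) (≡.sym (Finₚ.toℕ-injective x≡y)) xy))
  ... | tri> _ _ y<x = edge y x y<x (trans (Graph.sym G y x) xy) , backward

module _ (H : Graph) (c : Elem H → ℤ) where

  incidentLabels : Fin (n H) → List ℤ
  incidentLabels w = collect (adj H w) (λ _ wx → c (inj₂ (proj₁ (edgeJoining wx))))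

  length-incidentLabels : ∀ w → length (incidentLabels w) ≡ deg H w
  length-incidentLabels w = length-collect (adj H w) _

  ∈-incidentLabels : ∀ {w e} → Incident H w e → c (inj₂ e) ∈ incidentLabels w
  ∈-incidentLabels {w} {e} w∈e =
    let (x , e-wx) = incident⇒Joins w∈e
        wx = Joins⇒adj e-wx
    in subst (λ f → c (inj₂ f) ∈ incidentLabels w) (Joins⇒≡ (proj₂ (edgeJoining wx)) e-wx)
         (∈-collect (adj H w) _ x wx)

_∖_ : (G : Graph) → Edge G → Graph
G ∖ e = record
  { n      = n G
  ; adj    = λ x y → adj G x y ∧ not (does (joins? e x y))
  ; sym    = λ x y → cong₂ _∧_ (Graph.sym G x y)
                       (cong not (does-⇔ (mk⇔ Joins-sym Joins-sym) (joins? e x y) (joins? e y x)))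
  ; irrefl = λ x → cong (_∧ _) (irrefl G x)
  }

module EdgeDeletion (G : Graph) (e : Edge G) where

  ∖-adj⇒adj : ∀ {x y} → adj (G ∖ e) x y ≡ true → adj G x y ≡ true
  ∖-adj⇒adj {x} {y} = Boolₚ.∧-conicalˡ (adj G x y) _

  adj⇒∖-adj : ∀ {x y} → adj G x y ≡ true → ¬ Joins e x y → adj (G ∖ e) x y ≡ true
  adj⇒∖-adj {x} {y} xy ¬e-xy rewrite xy | dec-false (joins? e x y) ¬e-xy = refl

  ∖-¬adj : ∀ {x y} → Joins e x y → adj (G ∖ e) x y ≡ false
  ∖-¬adj {x} {y} e-xy rewrite dec-true (joins? e x y) e-xy = Boolₚ.∧-zeroʳ (adj G x y)

  ∖-subgraph : Subgraph (G ∖ e) G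
  ∖-subgraph = id , id , λ _ _ → ∖-adj⇒adj

  deg-∖-≤ : ∀ w → deg (G ∖ e) w ≤ deg G w
  deg-∖-≤ w = count-mono {f = adj (G ∖ e) w} (λ _ → ∖-adj⇒adj)

  deg-∖-< : ∀ {x y} → Joins e x y → deg (G ∖ e) x < deg G x
  deg-∖-< {x} {y} e-xy =
    count-< {f = adj (G ∖ e) x} (λ _ → ∖-adj⇒adj) y (∖-¬adj e-xy) (Joins⇒adj e-xy)

  size-∖-< : size (G ∖ e) < size G
  size-∖-< = ℕₚ.+-monoʳ-< (n G)
    (sumFin-< (λ i → count-mono {f = row (G ∖ e) i} (row-⊆ i)) (eu e)
      (count-< {f = row (G ∖ e) (eu e)} (row-⊆ (eu e)) (ev e)
        (trans (cong ((toℕ (eu e) <ᵇ toℕ (ev e)) ∧_) (∖-¬adj forward)) (Boolₚ.∧-zeroʳ _))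
        (cong₂ _∧_ (Equivalence.to Boolₚ.T-≡ (ℕₚ.<⇒<ᵇ (u<v e))) (isAdj e))))
    where
    row : (H : Graph) → Fin (n H) → Fin (n H) → Bool
    row H i j = (toℕ i <ᵇ toℕ j) ∧ adj H i j
    row-⊆ : ∀ i j → row (G ∖ e) i j ≡ true → row G i j ≡ true
    row-⊆ i j with toℕ i <ᵇ toℕ j
    ... | true  = ∖-adj⇒adj
    ... | false = λ ()

  lift : Edge (G ∖ e) → Edge G
  lift f = edge (eu f) (ev f) (u<v f) (∖-adj⇒adj (isAdj f))

  restrict : (f : Edge G) → f ≢ e → Edge (G ∖ e)
  restrict f f≢e = edge (eu f) (ev f) (u<v f)
    (adj⇒∖-adj (isAdj f) (λ e-f → f≢e (Joins⇒≡ forward e-f)))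

  lift-restrict : ∀ f (f≢e : f ≢ e) → lift (restrict f f≢e) ≡ f
  lift-restrict f f≢e = edge-≡ refl refl

-- Extending a labelling across a deleted edge

private
  length-++₃ : ∀ {a} {A : Set a} (xs ys zs : List A) →
               length (xs ++ ys ++ zs) ≡ length xs + (length ys + length zs)
  length-++₃ xs ys zs = trans (Listₚ.length-++ xs) (cong (λ m → length xs + m) (Listₚ.length-++ ys))

  +-<-+ : ∀ {p q P Q} t → p < P → q < Q → p + (q + suc t) < P + Q + t
  +-<-+ {p} {q} {P} {Q} t p<P q<Q =
    subst (_≤ P + Q + t) (rearrange p q t) (ℕₚ.+-monoˡ-≤ t (ℕₚ.+-mono-≤ p<P q<Q))
    where
    rearrange : ∀ p q t → suc p + suc q + t ≡ suc (p + (q + suc t))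
    rearrange = ℕ-Solver.solve-∀

  *-<-* : ∀ {p P} r → p < P → P + (p * suc (r + r) + suc (r + r)) ≤ P * (2 * suc r)
  *-<-* {p} {P} r p<P = begin
    P + (p * s + s) ≡⟨ cong (λ m → P + m) (ℕₚ.+-comm (p * s) s) ⟩
    P + suc p * s   ≤⟨ ℕₚ.+-monoʳ-≤ P (ℕₚ.*-monoˡ-≤ s p<P) ⟩
    P + P * s       ≡⟨ rearrange P r ⟩
    P * (2 * suc r) ∎
    where
    open ℕₚ.≤-Reasoning
    s : ℕ
    s = suc (r + r)
    rearrange : ∀ P r → P + P * suc (r + r) ≡ P * (2 * suc r)
    rearrange = ℕ-Solver.solve-∀

module Extension
  (r k : ℕ) {G : Graph} {e₀ : Edge G} {a b : Fin (n G)} (e₀-ab : Joins e₀ a b)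
  (budget-a : deg G a * (2 * suc r) < k) (budget-ab : deg G a + deg G b + (r + r) ≤ k)
  where

  open EdgeDeletion G e₀

  -- Labels must be at distance at least d = suc r, so ball r ℓ lists exactly the labels too close to ℓ.

  G′ : Graph
  G′ = G ∖ e₀

  module Recolour
    (L : Elem G → List ℤ) (L-ok : ∀ x → IsKList k (L x))
    (c′ : Elem G′ → ℤ)
    (c′-vertices : ∀ x y → adj G′ x y ≡ true → c′ (inj₁ x) ≢ c′ (inj₁ y))
    (c′-edges : ∀ f f′ → AdjacentEdges G′ f f′ → c′ (inj₂ f) ≢ c′ (inj₂ f′))
    (c′-far : ∀ w f → Incident G′ w f → suc r ≤ ∣ c′ (inj₁ w) ℤ.- c′ (inj₂ f) ∣)
    (c′-∈ : ∀ x → c′ x ∈ L (map₂ lift x))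
    where

    pick : ∀ x (F : List ℤ) → length F < k → ∃ λ ℓ → ℓ ∈ L x × ℓ ∉ F
    pick x F |F|<k = ∃∉-longer ℤ._≟_ (L x) F (proj₂ (L-ok x))
                       (subst (length F <_) (≡.sym (proj₁ (L-ok x))) |F|<k)

    edgeLabels : Fin (n G) → List ℤ
    edgeLabels = incidentLabels G′ c′

    forbidden-e₀ : List ℤ
    forbidden-e₀ = edgeLabels a ++ edgeLabels b ++ ball r (c′ (inj₁ b))

    |forbidden-e₀|<k : length forbidden-e₀ < k
    |forbidden-e₀|<k = begin-strict
      length forbidden-e₀                   ≡⟨ length-++₃ (edgeLabels a) (edgeLabels b) _ ⟩
      length (edgeLabels a) + (length (edgeLabels b) + length (ball r (c′ (inj₁ b))))
        ≡⟨ cong₂ _+_ (length-incidentLabels G′ c′ a)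
                     (cong₂ _+_ (length-incidentLabels G′ c′ b) (length-ball r (c′ (inj₁ b)))) ⟩
      deg G′ a + (deg G′ b + suc (r + r))
        <⟨ +-<-+ (r + r) (deg-∖-< e₀-ab) (deg-∖-< (Joins-sym e₀-ab)) ⟩
      deg G a + deg G b + (r + r)           ≤⟨ budget-ab ⟩
      k                                     ∎
      where open ℕₚ.≤-Reasoning

    ℓe : ℤ
    ℓe = proj₁ (pick (inj₂ e₀) forbidden-e₀ |forbidden-e₀|<k)

    ℓe∈L : ℓe ∈ L (inj₂ e₀)
    ℓe∈L = proj₁ (proj₂ (pick (inj₂ e₀) forbidden-e₀ |forbidden-e₀|<k))

    ℓe∉F : ℓe ∉ forbidden-e₀
    ℓe∉F = proj₂ (proj₂ (pick (inj₂ e₀) forbidden-e₀ |forbidden-e₀|<k))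

    neighbourLabels : List ℤ
    neighbourLabels = collect (adj G a) (λ x _ → c′ (inj₁ x))

    forbidden-a : List ℤ
    forbidden-a = neighbourLabels ++ balls r (edgeLabels a) ++ ball r ℓe

    |forbidden-a|<k : length forbidden-a < k
    |forbidden-a|<k = begin-strict
      length forbidden-a                    ≡⟨ length-++₃ neighbourLabels (balls r (edgeLabels a)) _ ⟩
      length neighbourLabels + (length (balls r (edgeLabels a)) + length (ball r ℓe))
        ≡⟨ cong₂ _+_ (length-collect (adj G a) _)
             (cong₂ _+_ (trans (length-balls r (edgeLabels a))
                               (cong (_* suc (r + r)) (length-incidentLabels G′ c′ a)))
                        (length-ball r ℓe)) ⟩
      deg G a + (deg G′ a * suc (r + r) + suc (r + r)) ≤⟨ *-<-* r (deg-∖-< e₀-ab) ⟩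
      deg G a * (2 * suc r)                 <⟨ budget-a ⟩
      k                                     ∎
      where open ℕₚ.≤-Reasoning

    ℓa : ℤ
    ℓa = proj₁ (pick (inj₁ a) forbidden-a |forbidden-a|<k)

    ℓa∈L : ℓa ∈ L (inj₁ a)
    ℓa∈L = proj₁ (proj₂ (pick (inj₁ a) forbidden-a |forbidden-a|<k))

    ℓa∉F : ℓa ∉ forbidden-a
    ℓa∉F = proj₂ (proj₂ (pick (inj₁ a) forbidden-a |forbidden-a|<k))

    vertexLabel : (w : Fin (n G)) → Dec (w ≡ a) → ℤ
    vertexLabel _ (yes _) = ℓa
    vertexLabel w (no _)  = c′ (inj₁ w)

    edgeLabel : (f : Edge G) → Dec (f ≡ e₀) → ℤ
    edgeLabel _ (yes _)   = ℓe
    edgeLabel f (no f≢e₀) = c′ (inj₂ (restrict f f≢e₀))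

    c : Elem G → ℤ
    c (inj₁ w) = vertexLabel w (w Fin.≟ a)
    c (inj₂ f) = edgeLabel f (f ≟ₑ e₀)

    ℓa≢neighbour : ∀ {y} → adj G a y ≡ true → ℓa ≢ c′ (inj₁ y)
    ℓa≢neighbour {y} ay ℓa≡ =
      ℓa∉F (∈-++⁺ˡ (subst (_∈ neighbourLabels) (≡.sym ℓa≡) (∈-collect (adj G a) _ y ay)))

    ℓe≢near : ∀ {x f} → Incident G′ x f → x ≡ a ⊎ x ≡ b → ℓe ≢ c′ (inj₂ f)
    ℓe≢near x∈f (inj₁ refl) ℓe≡ =
      ℓe∉F (∈-++⁺ˡ (subst (_∈ edgeLabels a) (≡.sym ℓe≡) (∈-incidentLabels G′ c′ x∈f)))
    ℓe≢near x∈f (inj₂ refl) ℓe≡ =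
      ℓe∉F (∈-++⁺ʳ (edgeLabels a)
             (∈-++⁺ˡ (subst (_∈ edgeLabels b) (≡.sym ℓe≡) (∈-incidentLabels G′ c′ x∈f))))

    vertices-differ : ∀ x y → adj G x y ≡ true → (x? : Dec (x ≡ a)) (y? : Dec (y ≡ a)) →
                      vertexLabel x x? ≢ vertexLabel y y?
    vertices-differ x y xy (yes refl) (yes refl) _ = ¬adj-self {G = G} xy
    vertices-differ x y xy (yes refl) (no _)       = ℓa≢neighbour xy
    vertices-differ x y xy (no _)     (yes refl)   = ℓa≢neighbour (trans (Graph.sym G a x) xy) ∘ ≡.sym
    vertices-differ x y xy (no x≢a)   (no y≢a)     =
      c′-vertices x y (adj⇒∖-adj xy ([ x≢a , y≢a ] ∘ Joins-endpoint e₀-ab))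

    edges-differ : ∀ f f′ → AdjacentEdges G f f′ → (f? : Dec (f ≡ e₀)) (f′? : Dec (f′ ≡ e₀)) →
                   edgeLabel f f? ≢ edgeLabel f′ f′?
    edges-differ f f′ (_ , f≠f′)            (yes refl) (yes refl) _ = f≠f′ (refl , refl)
    edges-differ f f′ ((x , x∈f , x∈f′) , _) (yes refl) (no f′≢e₀)   =
      ℓe≢near {f = restrict f′ f′≢e₀} x∈f′ (Joins-incident e₀-ab x∈f)
    edges-differ f f′ ((x , x∈f , x∈f′) , _) (no f≢e₀)  (yes refl)   =
      ℓe≢near {f = restrict f f≢e₀} x∈f (Joins-incident e₀-ab x∈f′) ∘ ≡.sym
    edges-differ f f′ f~f′                  (no f≢e₀)  (no f′≢e₀)   =
      c′-edges (restrict f f≢e₀) (restrict f′ f′≢e₀) f~f′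

    labels-far : ∀ w f → Incident G w f → (w? : Dec (w ≡ a)) (f? : Dec (f ≡ e₀)) →
                 suc r ≤ ∣ vertexLabel w w? ℤ.- edgeLabel f f? ∣
    labels-far w f w∈f (yes refl) (yes refl) =
      ∉-ball⇒far (ℓa∉F ∘ ∈-++⁺ʳ neighbourLabels ∘ ∈-++⁺ʳ (balls r (edgeLabels a)))
    labels-far w f w∈f (yes refl) (no f≢e₀) =
      ∉-balls⇒far (ℓa∉F ∘ ∈-++⁺ʳ neighbourLabels ∘ ∈-++⁺ˡ)
        (∈-incidentLabels G′ c′ {e = restrict f f≢e₀} w∈f)
    labels-far w f w∈f (no w≢a) (yes refl) with Joins-incident e₀-ab w∈f
    ... | inj₁ w≡a  = ⊥-elim (w≢a w≡a)
    ... | inj₂ refl = subst (suc r ≤_) (ℤₚ.∣i-j∣≡∣j-i∣ ℓe (c′ (inj₁ b)))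
                        (∉-ball⇒far (ℓe∉F ∘ ∈-++⁺ʳ (edgeLabels a) ∘ ∈-++⁺ʳ (edgeLabels b)))
    labels-far w f w∈f (no _) (no f≢e₀) = c′-far w (restrict f f≢e₀) w∈f

    vertexLabel-∈ : ∀ w (w? : Dec (w ≡ a)) → vertexLabel w w? ∈ L (inj₁ w)
    vertexLabel-∈ w (yes refl) = ℓa∈L
    vertexLabel-∈ w (no _)     = c′-∈ (inj₁ w)

    edgeLabel-∈ : ∀ f (f? : Dec (f ≡ e₀)) → edgeLabel f f? ∈ L (inj₂ f)
    edgeLabel-∈ f (yes refl) = ℓe∈L
    edgeLabel-∈ f (no f≢e₀)  =
      subst (λ g → c′ (inj₂ (restrict f f≢e₀)) ∈ L (inj₂ g)) (lift-restrict f f≢e₀)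
        (c′-∈ (inj₂ (restrict f f≢e₀)))

    labelling : ∃ λ c → IsD1TotalLabelling (suc r) G c × (∀ x → c x ∈ L x)
    labelling = c
      , ( (λ x y xy → vertices-differ x y xy (x Fin.≟ a) (y Fin.≟ a))
        , (λ f f′ f~f′ → edges-differ f f′ f~f′ (f ≟ₑ e₀) (f′ ≟ₑ e₀))
        , (λ w f w∈f → labels-far w f w∈f (w Fin.≟ a) (f ≟ₑ e₀)) )
      , λ { (inj₁ w) → vertexLabel-∈ w (w Fin.≟ a) ; (inj₂ f) → edgeLabel-∈ f (f ≟ₑ e₀) }

  extend : TotalChoosable (suc r) k G′ → TotalChoosable (suc r) k G
  extend choosable L L-ok =
    let (c′ , (c′-vertices , c′-edges , c′-far) , c′-∈) =
          choosable (L ∘ map₂ lift) (L-ok ∘ map₂ lift)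
    in Recolour.labelling L L-ok c′ c′-vertices c′-edges c′-far c′-∈

lowEndpoint : (G : Graph) (e : Edge G) →
              ∃₂ λ a b → Joins e a b × deg G a ≡ deg G (eu e) ⊓ deg G (ev e)
                                     × deg G a + deg G b ≡ deg G (eu e) + deg G (ev e)
lowEndpoint G e with ℕₚ.⊓-sel (deg G (eu e)) (deg G (ev e))
... | inj₁ min≡u = eu e , ev e , forward , ≡.sym min≡u , refl
... | inj₂ min≡v = ev e , eu e , backward , ≡.sym min≡v , ℕₚ.+-comm (deg G (ev e)) _

m≤[t+n∸1]/n⇒m*n<t+n : ∀ {m} t n .{{_ : NonZero n}} → m ≤ (t + n ∸ 1) / n → m * n < t + n
m≤[t+n∸1]/n⇒m*n<t+n {m} t n m≤ = ℕₚ.≤-<-trans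
  (ℕₚ.≤-trans (ℕₚ.*-monoˡ-≤ n m≤) (m/n*n≤m (t + n ∸ 1) n))
  (ℕₚ.∸-monoʳ-< (s≤s z≤n) (ℕₚ.≤-trans (>-nonZero⁻¹ n) (ℕₚ.m≤n+m n t)))

m<M+3⇒m+[r+r]≤M+2[1+r] : ∀ {m} M r → m < M + 3 → m + (r + r) ≤ M + 2 * suc r
m<M+3⇒m+[r+r]≤M+2[1+r] {m} M r m<M+3 =
  ℕₚ.≤-pred (subst (suc (m + (r + r)) ≤_) (rearrange M r) (ℕₚ.+-monoˡ-≤ (r + r) m<M+3))
  where
  rearrange : ∀ M r → M + 3 + (r + r) ≡ suc (M + 2 * suc r)
  rearrange = ℕ-Solver.solve-∀

lemma2p3 : (d : ℕ) → 2 ≤ d → (S : Surface) → (M : ℕ) → MCondition d (euler S) M →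
    (G : Graph) → MinimalCounterexample d M S G →
    (e : Edge G) → deg G (eu e) ⊓ deg G (ev e) ≤ degBound d M →
    M + 3 ≤ deg G (eu e) + deg G (ev e)
lemma2p3 (suc r) _ S M _ G (embedded , Δ≤M , ¬choosable , minimal) e min≤bound
  with M + 3 ≤? deg G (eu e) + deg G (ev e) | lowEndpoint G e
... | yes enough | _ = enough
... | no ¬enough | a , b , e-ab , deg-a≡min , deg-ab≡sum =
  ⊥-elim (¬choosable (Extension.extend r (M + 2 * suc r) e-ab budget-a budget-ab choosable-G∖e))
  where
  open EdgeDeletion G e

  budget-a : deg G a * (2 * suc r) < M + 2 * suc r
  budget-a = m≤[t+n∸1]/n⇒m*n<t+n M (2 * suc r)
               (subst (_≤ degBound (suc r) M) (≡.sym deg-a≡min) min≤bound)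

  budget-ab : deg G a + deg G b + (r + r) ≤ M + 2 * suc r
  budget-ab = m<M+3⇒m+[r+r]≤M+2[1+r] M r (subst (_< M + 3) (≡.sym deg-ab≡sum) (ℕₚ.≰⇒> ¬enough))

  choosable-G∖e : TotalChoosable (suc r) (M + 2 * suc r) (G ∖ e)
  choosable-G∖e = minimal (G ∖ e) (subgraph-closed S ∖-subgraph embedded)
                    (λ w → ℕₚ.≤-trans (deg-∖-≤ w) (Δ≤M w)) size-∖-<
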